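{- For $n \ge 1$ let $K_{n,n,n}$ denote the complete tripartite graph with all three parts of order $n$. Then $\chi_{\rho}(S(K_{n,n,n})) \to \infty$ as $n \to \infty$.
   Context: All graphs are simple. For a positive integer $i$, an $i$-packing in a graph $G$ is a set $W\subseteq V(G)$ such that any two distinct vertices of $W$ are at distance greater than $i$ in $G$. The packing chromatic number $\chi_{\rho}(G)$ is the smallest integer $k$ such that $V(G)$ can be partitioned into sets $\Pi_1,\ldots,\Pi_k$ where $\Pi_i$ is an $i$-packing for each $i\in[k]$. The subdivision $S(G)$ of $G$ is the graph obtained from $G$ by replacing each edge by a path of length $2$ (i.e. inserting one new vertex on each edge). -}

module Defs where

open import Data.Nat using (ℕ; zero; suc; _<_)
open import Data.Fin using (Fin; toℕ) renaming (_<_ to _<ᶠ_)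
open import Data.Product using (Σ; _×_; _,_; proj₁; proj₂; Σ-syntax)
open import Data.Sum using (_⊎_; inj₁; inj₂)
open import Data.Empty using (⊥)
open import Relation.Binary.PropositionalEquality using (_≡_; _≢_)
open import Relation.Nullary using (¬_)

record Graph : Set₁ where
  field
    V   : Set
    Adj : V → V → Set
open Graph public

-- Within G d u v : there is a walk of length at most d from u to v,
-- i.e. dist_G(u,v) ≤ d.
data Within (G : Graph) : ℕ → V G → V G → Set where
  here : ∀ {d u} → Within G d u u
  step : ∀ {d u w v} → Adj G u w → Within G d w v → Within G (suc d) u v

IsPacking : (G : Graph) → ℕ → (V G → Set) → Set
IsPacking G i W = ∀ u v → W u → W v → u ≢ v → ¬ Within G i u v

-- Partition of V(G) into Π_1,…,Π_k with Π_i an i-packing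
-- (colour j : Fin k stands for class Π_{toℕ j + 1}).
PackingColoring : Graph → ℕ → Set
PackingColoring G k =
  Σ[ c ∈ (V G → Fin k) ] ∀ (j : Fin k) → IsPacking G (suc (toℕ j)) (λ v → c v ≡ j)

χρ≥ : Graph → ℕ → Set
χρ≥ G M = ∀ k → k < M → ¬ PackingColoring G k

-- A simple graph presented by its vertex set, its edge set, and the
-- endpoints of each edge (each edge listed once).
record EdgeGraph : Set₁ where
  field
    Vert : Set
    Edge : Set
    ends : Edge → Vert × Vert
open EdgeGraph public

S : EdgeGraph → Graph
S G = record { V = Vert G ⊎ Edge G ; Adj = adj }
  where
  inc : Vert G → Edge G → Set
  inc v e = (v ≡ proj₁ (ends G e)) ⊎ (v ≡ proj₂ (ends G e))
  adj : Vert G ⊎ Edge G → Vert G ⊎ Edge G → Set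
  adj (inj₁ v) (inj₁ w) = ⊥
  adj (inj₁ v) (inj₂ e) = inc v e
  adj (inj₂ e) (inj₁ v) = inc v e
  adj (inj₂ e) (inj₂ f) = ⊥

-- K_{n,n,n}: vertices (part, index) ∈ Fin 3 × Fin n; one edge between
-- (i,a) and (j,b) for each i < j (all pairs in different parts).
K₃ : ℕ → EdgeGraph
K₃ n = record
  { Vert = Fin 3 × Fin n
  ; Edge = Σ[ i ∈ Fin 3 ] Σ[ j ∈ Fin 3 ] (i <ᶠ j) × Fin n × Fin n
  ; ends = λ { (i , j , _ , a , b) → ((i , a) , (j , b)) }
  }

-- In a packing colouring of S(K_{n,n,n}) with k < n colours, colour 1 cannot occur on an
-- original vertex v: the n subdivision vertices on the edges from v to another part are
-- pairwise at distance 2, so they would need n distinct colours. Hence the three original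
-- vertices (0,a), (1,a), (2,a), pairwise at distance 2, get distinct colours ≥ 2, and one of
-- them gets a colour ≥ 4. Choosing such a vertex for each index a gives n original vertices
-- pairwise at distance ≤ 4, all with colours ≥ 4 — again n colours are needed. So χ_ρ ≥ n.
module Submission where

open import Defs
open import Data.Nat using (ℕ; zero; suc; pred; _+_; _≤_; _<_; z≤n; s≤s; _≤?_)
open import Data.Nat.Properties using (<-≤-trans; ≤-pred; n<1+n; m≤n+m; n≢0⇒n>0; ≰⇒>)
open import Data.Fin using (Fin; toℕ; fromℕ<) renaming (zero to fzero; suc to fsuc)
open import Data.Fin.Properties using (_≟_; <-cmp; any?; pigeonhole; <⇒≢; toℕ-injective; toℕ-fromℕ<)
open import Data.Product using (∃-syntax; _,_; proj₁; proj₂)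
open import Data.Sum using (_⊎_; inj₁; inj₂)
open import Data.Sum.Properties using (inj₂-injective)
open import Data.Empty using (⊥; ⊥-elim)
open import Function using (_∘_)
open import Function.Definitions using (Injective)
open import Relation.Binary.Definitions using (tri<; tri≈; tri>)
open import Relation.Binary.PropositionalEquality using (_≡_; _≢_; refl; sym; trans; cong; module ≡-Reasoning)
open import Relation.Nullary using (¬_; yes; no)
open import Relation.Nullary.Decidable using (decidable-stable)

Within-mono : ∀ {G d e u v} → Within G d u v → d ≤ e → Within G e u v
Within-mono here            _       = here
Within-mono (step uw wv) (s≤s d≤e) = step uw (Within-mono wv d≤e)

Within-trans : ∀ {G d e u w v} → Within G d u w → Within G e w v → Within G (d + e) u v
Within-trans {d = d} here w⇝v = Within-mono w⇝v (m≤n+m _ d)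
Within-trans (step uw′ w′⇝w) w⇝v = step uw′ (Within-trans w′⇝w w⇝v)

χρ≥-mono : ∀ {G M N} → M ≤ N → χρ≥ G N → χρ≥ G M
χρ≥-mono M≤N χρ≥N k k<M = χρ≥N k (<-≤-trans k<M M≤N)

pred<-of-≤ : ∀ {x m} → x ≢ 0 → x ≤ m → pred x < m
pred<-of-≤ {zero}  x≢0 _   = ⊥-elim (x≢0 refl)
pred<-of-≤ {suc x} _   x<m = x<m

pred-injective-≢0 : ∀ {x y} → x ≢ 0 → y ≢ 0 → pred x ≡ pred y → x ≡ y
pred-injective-≢0 {zero}  {_}     x≢0 _   _    = ⊥-elim (x≢0 refl)
pred-injective-≢0 {suc _} {zero}  _   y≢0 _    = ⊥-elim (y≢0 refl)
pred-injective-≢0 {suc _} {suc _} _   _   refl = refl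

distinct-positive-large : ∀ {m} (x : Fin (suc m) → ℕ) → (∀ p → x p ≢ 0) →
                          Injective _≡_ _≡_ x → ∃[ p ] suc m ≤ x p
distinct-positive-large {m} x x≢0 x-inj =
  decidable-stable (any? (λ p → suc m ≤? x p)) λ ¬large →
    let (i , j , i<j , same) = pigeonhole (n<1+n m) (slot ¬large)
    in <⇒≢ i<j (x-inj (pred-injective-≢0 (x≢0 i) (x≢0 j) (begin
         pred (x i)             ≡⟨ toℕ-fromℕ< _ ⟨
         toℕ (slot ¬large i)   ≡⟨ cong toℕ same ⟩
         toℕ (slot ¬large j)   ≡⟨ toℕ-fromℕ< _ ⟩
         pred (x j)             ∎)))
  where
  open ≡-Reasoning
  slot : ¬ (∃[ p ] suc m ≤ x p) → Fin (suc m) → Fin m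
  slot ¬large p = fromℕ< (pred<-of-≤ (x≢0 p) (≤-pred (≰⇒> (¬large ∘ (p ,_)))))

module _ {G : Graph} {k : ℕ} (χ : PackingColoring G k) where
  private
    colour = proj₁ χ

  sameColour-¬Within : ∀ {d u v} → u ≢ v → colour u ≡ colour v →
                       d ≤ suc (toℕ (colour u)) → ¬ Within G d u v
  sameColour-¬Within {u = u} {v} u≢v same d≤ u⇝v =
    proj₂ χ (colour u) u v refl (sym same) u≢v (Within-mono u⇝v d≤)

  packing-pigeonhole : ∀ {n d} → k < n → (f : Fin n → V G) → Injective _≡_ _≡_ f →
                       (∀ i j → Within G d (f i) (f j)) → ¬ (∀ i → d ≤ suc (toℕ (colour (f i))))
  packing-pigeonhole k<n f f-inj within large with pigeonhole k<n (colour ∘ f)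
  ... | i , j , i<j , same = sameColour-¬Within (<⇒≢ i<j ∘ f-inj) same (large i) (within i j)

Incident : (G : EdgeGraph) → Vert G → Edge G → Set
Incident G v e = (v ≡ proj₁ (ends G e)) ⊎ (v ≡ proj₂ (ends G e))

S-commonEdge-within2 : ∀ {G u v} (e : Edge G) → Incident G u e → Incident G v e →
                       Within (S G) 2 (inj₁ u) (inj₁ v)
S-commonEdge-within2 e u∈e v∈e = step {w = inj₂ e} u∈e (step v∈e here)

S-commonEnd-within2 : ∀ {G v} {e f : Edge G} → Incident G v e → Incident G v f →
                      Within (S G) 2 (inj₂ e) (inj₂ f)
S-commonEnd-within2 {v = v} v∈e v∈f = step {w = inj₁ v} v∈e (step v∈f here)

module _ {n : ℕ} where

  edgeBetween : ∀ {p q : Fin 3} → p ≢ q → Fin n → Fin n → Edge (K₃ n)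
  edgeBetween {p} {q} p≢q a b with <-cmp p q
  ... | tri< p<q _ _ = p , q , p<q , a , b
  ... | tri≈ _ p≡q _ = ⊥-elim (p≢q p≡q)
  ... | tri> _ _ q<p = q , p , q<p , b , a

  edgeBetween-incidentˡ : ∀ {p q} (p≢q : p ≢ q) a b → Incident (K₃ n) (p , a) (edgeBetween p≢q a b)
  edgeBetween-incidentˡ {p} {q} p≢q a b with <-cmp p q
  ... | tri< _ _ _   = inj₁ refl
  ... | tri≈ _ p≡q _ = ⊥-elim (p≢q p≡q)
  ... | tri> _ _ _   = inj₂ refl

  edgeBetween-incidentʳ : ∀ {p q} (p≢q : p ≢ q) a b → Incident (K₃ n) (q , b) (edgeBetween p≢q a b)
  edgeBetween-incidentʳ {p} {q} p≢q a b with <-cmp p q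
  ... | tri< _ _ _   = inj₂ refl
  ... | tri≈ _ p≡q _ = ⊥-elim (p≢q p≡q)
  ... | tri> _ _ _   = inj₁ refl

  edgeBetween-injectiveʳ : ∀ {p q} (p≢q : p ≢ q) a → Injective _≡_ _≡_ (edgeBetween p≢q a)
  edgeBetween-injectiveʳ {p} {q} p≢q a with <-cmp p q
  ... | tri< _ _ _   = λ { refl → refl }
  ... | tri≈ _ p≡q _ = ⊥-elim (p≢q p≡q)
  ... | tri> _ _ _   = λ { refl → refl }

  otherPart : Fin 3 → Fin 3
  otherPart fzero    = fsuc fzero
  otherPart (fsuc _) = fzero

  otherPart-≢ : ∀ p → p ≢ otherPart p
  otherPart-≢ fzero    ()
  otherPart-≢ (fsuc _) ()

  parts-within2 : ∀ {p q} → p ≢ q → (a b : Fin n) → Within (S (K₃ n)) 2 (inj₁ (p , a)) (inj₁ (q , b))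
  parts-within2 p≢q a b =
    S-commonEdge-within2 (edgeBetween p≢q a b) (edgeBetween-incidentˡ p≢q a b) (edgeBetween-incidentʳ p≢q a b)

  vertices-within4 : ∀ p q (a b : Fin n) → Within (S (K₃ n)) 4 (inj₁ (p , a)) (inj₁ (q , b))
  vertices-within4 p q a b with p ≟ q
  ... | no p≢q   = Within-mono (parts-within2 p≢q a b) (s≤s (s≤s z≤n))
  ... | yes refl = Within-trans (parts-within2 (otherPart-≢ p) a a) (parts-within2 (otherPart-≢ p ∘ sym) a b)

  module _ {k : ℕ} (k<n : k < n) (χ : PackingColoring (S (K₃ n)) k) where
    private
      colour = proj₁ χ

    noVertexColouredOne : ∀ v → toℕ (colour (inj₁ v)) ≢ 0
    noVertexColouredOne (p , a) v↦0 =
      packing-pigeonhole χ k<n neighbour (edgeBetween-injectiveʳ p≢q a ∘ inj₂-injective) within2 colour≥2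
      where
      p≢q = otherPart-≢ p
      neighbour : Fin n → V (S (K₃ n))
      neighbour b = inj₂ (edgeBetween p≢q a b)
      within2 : ∀ b c → Within (S (K₃ n)) 2 (neighbour b) (neighbour c)
      within2 b c = S-commonEnd-within2 (edgeBetween-incidentˡ p≢q a b) (edgeBetween-incidentˡ p≢q a c)
      colour≥2 : ∀ b → 2 ≤ suc (toℕ (colour (neighbour b)))
      colour≥2 b = s≤s (n≢0⇒n>0 λ b↦0 →
        sameColour-¬Within χ (λ ()) (toℕ-injective (trans b↦0 (sym v↦0))) (s≤s z≤n)
          (step (edgeBetween-incidentˡ p≢q a b) here))

    largeColourAt : ∀ a → ∃[ p ] 3 ≤ toℕ (colour (inj₁ (p , a)))
    largeColourAt a =
      distinct-positive-large (λ p → toℕ (colour (inj₁ (p , a)))) (λ p → noVertexColouredOne (p , a)) distinct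
      where
      distinct : Injective _≡_ _≡_ (λ p → toℕ (colour (inj₁ (p , a))))
      distinct {p} {q} same = decidable-stable (p ≟ q) λ p≢q →
        sameColour-¬Within χ (λ { refl → p≢q refl }) (toℕ-injective same)
          (s≤s (n≢0⇒n>0 (noVertexColouredOne (p , a)))) (parts-within2 p≢q a a)

    noPackingColoring : ⊥
    noPackingColoring =
      packing-pigeonhole χ k<n largeVertex (λ { refl → refl }) (λ a b → vertices-within4 _ _ a b)
        (λ a → s≤s (proj₂ (largeColourAt a)))
      where
      largeVertex : Fin n → V (S (K₃ n))
      largeVertex a = inj₁ (proj₁ (largeColourAt a) , a)

S-K₃-χρ≥ : ∀ n → χρ≥ (S (K₃ n)) n
S-K₃-χρ≥ n k k<n χ = noPackingColoring k<n χ

mainTheorem1 : ∀ (M : ℕ) → ∃[ N ] (∀ (n : ℕ) → 1 ≤ n → N ≤ n → χρ≥ (S (K₃ n)) M)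
mainTheorem1 M = M , λ n _ M≤n → χρ≥-mono M≤n (S-K₃-χρ≥ n)
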